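{- Let $\mathcal{M}$ be a Carlson model and let a rule instance of $\mathrm{labCS}^\infty$ with conclusion $\mathfrak{S}$ and premisses $\mathfrak{S}_1,\dots,\mathfrak{S}_n$ be given. If a sequent interpretation $I$ of $\mathfrak{S}$ on $\mathcal{M}$ witnesses $\mathcal{M}\nVdash\mathfrak{S}$ (i.e. $\mathcal{M},I(x)\Vdash A$ for all $x:A$ on the left of $\mathfrak{S}$ and $\mathcal{M},I(y)\nVdash B$ for all $y:B$ on the right of $\mathfrak{S}$), then there are an index $i$ and a sequent interpretation $I'$ of $\mathfrak{S}_i$ on $\mathcal{M}$ witnessing $\mathcal{M}\nVdash\mathfrak{S}_i$ such that $I'$ is either equal to $I$ or extends $I$.
   Context: Formulas are built from a countable set $\mathtt{Prop}$ of propositional atoms by $A::=\bot\mid p\mid A\to A\mid\Box A\mid\triangle A$. A Carlson model is $\mathcal{M}=\langle W,\prec,M_0,M_1,V\rangle$ with $W$ a non-empty set, $\prec\subseteq W\times W$ transitive and conversely wellfounded, $M_0,M_1\subseteq W$, and $V:\mathtt{Prop}\to\mathcal{P}(W)$. Truth: $\mathcal{M},x\nVdash\bot$; $\mathcal{M},x\Vdash p$ iff $x\in V(p)$; $\mathcal{M},x\Vdash A\to B$ iff $\mathcal{M},x\nVdash A$ or $\mathcal{M},x\Vdash B$; $\mathcal{M},x\Vdash\Box A$ iff $\mathcal{M},y\Vdash A$ for all $y$ with $x\prec y$ and $y\in M_0$; $\mathcal{M},x\Vdash\triangle A$ iff $\mathcal{M},y\Vdash A$ for all $y$ with $x\prec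 y$ and $y\in M_1$. Fix a countable set $\mathtt{Lab}$ of labels. A labelled formula is $x:A$; a relational atom is $xRy$ or $xSy$. A sequent $\mathfrak{S}=\mathcal{R},\Gamma\Rightarrow\Omega$ consists of a finite multiset $\mathcal{R}$ of relational atoms and finite multisets $\Gamma$ (left) and $\Omega$ (right) of labelled formulas; $Lab(\mathfrak{S})$ is its set of labels. The rules of $\mathrm{labCS}^\infty$ (premisses / conclusion) are: (Id) no premiss, conclusion $\mathcal{R},\Gamma,x:p\Rightarrow x:p,\Omega$, $p\in\mathtt{Prop}$; ($\bot$) no premiss, conclusion $\mathcal{R},\Gamma,x:\bot\Rightarrow\Omega$; ($\to$R) from $\mathcal{R},\Gamma,x:A\Rightarrow x:B,\Omega$ infer $\mathcal{R},\Gamma\Rightarrow x:A\to B,\Omega$; ($\to$L) from $\mathcal{R},\Gamma\Rightarrow x:A,\Omega$ and $\mathcal{R},\Gamma,x:B\Rightarrow\Omega$ infer $\mathcal{R},\Gamma,x:A\to B\Rightarrow\Omega$; ($\Box$R) from $\mathcal{R},xRy,\Gamma\Rightarrow y:A,\Omega$ infer $\mathcal{R},\Gamma\Rightarrow x:\Box A,\Omega$, $y$ not occurring in the conclusion; ($\Box$L) from $\mathcal{R},xRy,x:\Box A,y:A,\Gamma\Rightarrow\Omega$ infer $\mathcal{R},xRy,x:\Box A,\Gamma\Rightarrow\Omega$; ($\triangle$R) from $\mathcal{R},xSy,\Gamma\Rightarrow y:A,\Omega$ infer $\mathcal{R},\Gamma\Rightarrow x:\triangle A,\Omega$, $y$ not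 occurring in the conclusion; ($\triangle$L) from $\mathcal{R},xSy,x:\triangle A,y:A,\Gamma\Rightarrow\Omega$ infer $\mathcal{R},xSy,x:\triangle A,\Gamma\Rightarrow\Omega$; ($\mathrm{trans}_{\circ\bullet}$, $\circ,\bullet\in\{R,S\}$) from $\mathcal{R},x\circ y,y\bullet z,x\bullet z,\Gamma\Rightarrow\Omega$ infer $\mathcal{R},x\circ y,y\bullet z,\Gamma\Rightarrow\Omega$. A sequent interpretation of $\mathfrak{S}=\mathcal{R},\Gamma\Rightarrow\Omega$ on $\mathcal{M}$ is a map $I:Lab(\mathfrak{S})\to W$ such that $xRy\in\mathcal{R}$ implies $I(x)\prec I(y)$ and $I(y)\in M_0$, and $xSy\in\mathcal{R}$ implies $I(x)\prec I(y)$ and $I(y)\in M_1$. $\mathcal{M}\nVdash\mathfrak{S}$ means some sequent interpretation $I$ makes all formulas of $\Gamma$ true and all formulas of $\Omega$ false; such an $I$ is said to witness $\mathcal{M}\nVdash\mathfrak{S}$. -}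

module Defs where

open import Level using (0ℓ)
open import Data.Nat using (ℕ)
open import Data.Empty using (⊥)
open import Data.Sum using (_⊎_)
open import Data.Product using (_×_; Σ)
open import Data.List using (List; []; _∷_; _++_; concatMap)
open import Data.List.Relation.Unary.All using (All)
open import Data.List.Relation.Binary.Pointwise using (Pointwise)
open import Data.List.Relation.Binary.Permutation.Propositional using (_↭_)
open import Data.List.Membership.Propositional using (_∈_; _∉_)
open import Relation.Nullary using (¬_)
open import Relation.Unary using (Pred)
open import Relation.Binary.Definitions using (Transitive)
open import Induction.WellFounded using (WellFounded)
open import Function using (flip)

Atom : Set
Atom = ℕ

Label : Set
Label = ℕ

data Fm : Set where
  ⊥' : Fm
  at : Atom → Fm
  _⇒_ : Fm → Fm → Fm
  □ : Fm → Fm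
  △ : Fm → Fm

record Carlson : Set₁ where
  field
    W     : Set
    w₀    : W                          -- W is non-empty
    _≺_   : W → W → Set
    ≺-trans : Transitive _≺_
    ≺-cwf : WellFounded (flip _≺_)
    M₀    : Pred W 0ℓ
    M₁    : Pred W 0ℓ
    V     : Atom → Pred W 0ℓ

open Carlson public

Forces : (M : Carlson) → W M → Fm → Set
Forces M x ⊥' = ⊥
Forces M x (at p) = V M p x
Forces M x (A ⇒ B) = (¬ Forces M x A) ⊎ Forces M x B
Forces M x (□ A) = ∀ y → _≺_ M x y → M₀ M y → Forces M y A
Forces M x (△ A) = ∀ y → _≺_ M x y → M₁ M y → Forces M y A

record LFm : Set where
  constructor _∶_
  field
    lab : Label
    fm  : Fm

data Kind : Set where
  R S : Kind

record RelAtom : Set where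
  constructor rel
  field
    kind : Kind
    src  : Label
    tgt  : Label

-- Sequents  𝓡, Γ ⇒ Ω  (multisets represented by lists, taken up to permutation
-- in the notion of rule instance below)
record Sequent : Set where
  constructor seq
  field
    rels : List RelAtom
    ant  : List LFm
    suc  : List LFm

open Sequent public

labelsR : List RelAtom → List Label
labelsR [] = []
labelsR (rel _ x y ∷ rs) = x ∷ y ∷ labelsR rs

labelsF : List LFm → List Label
labelsF [] = []
labelsF ((x ∶ _) ∷ fs) = x ∷ labelsF fs

labels : Sequent → List Label
labels (seq rs Γ Ω) = labelsR rs ++ labelsF Γ ++ labelsF Ω

-- Rule schemata of labCS^∞ (principal items written at the front).
-- Rule ps c : c is the conclusion and ps the list of premisses.
data Rule : List Sequent → Sequent → Set where
  Id   : ∀ {𝓡 Γ Ω x p} →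
         Rule [] (seq 𝓡 ((x ∶ at p) ∷ Γ) ((x ∶ at p) ∷ Ω))
  ⊥L   : ∀ {𝓡 Γ Ω x} →
         Rule [] (seq 𝓡 ((x ∶ ⊥') ∷ Γ) Ω)
  ⇒R   : ∀ {𝓡 Γ Ω x A B} →
         Rule (seq 𝓡 ((x ∶ A) ∷ Γ) ((x ∶ B) ∷ Ω) ∷ [])
              (seq 𝓡 Γ ((x ∶ (A ⇒ B)) ∷ Ω))
  ⇒L   : ∀ {𝓡 Γ Ω x A B} →
         Rule (seq 𝓡 Γ ((x ∶ A) ∷ Ω) ∷ seq 𝓡 ((x ∶ B) ∷ Γ) Ω ∷ [])
              (seq 𝓡 ((x ∶ (A ⇒ B)) ∷ Γ) Ω)
  □R   : ∀ {𝓡 Γ Ω x y A} →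
         y ∉ labels (seq 𝓡 Γ ((x ∶ □ A) ∷ Ω)) →
         Rule (seq (rel R x y ∷ 𝓡) Γ ((y ∶ A) ∷ Ω) ∷ [])
              (seq 𝓡 Γ ((x ∶ □ A) ∷ Ω))
  □L   : ∀ {𝓡 Γ Ω x y A} →
         Rule (seq (rel R x y ∷ 𝓡) ((x ∶ □ A) ∷ (y ∶ A) ∷ Γ) Ω ∷ [])
              (seq (rel R x y ∷ 𝓡) ((x ∶ □ A) ∷ Γ) Ω)
  △R   : ∀ {𝓡 Γ Ω x y A} →
         y ∉ labels (seq 𝓡 Γ ((x ∶ △ A) ∷ Ω)) →
         Rule (seq (rel S x y ∷ 𝓡) Γ ((y ∶ A) ∷ Ω) ∷ [])
              (seq 𝓡 Γ ((x ∶ △ A) ∷ Ω))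
  △L   : ∀ {𝓡 Γ Ω x y A} →
         Rule (seq (rel S x y ∷ 𝓡) ((x ∶ △ A) ∷ (y ∶ A) ∷ Γ) Ω ∷ [])
              (seq (rel S x y ∷ 𝓡) ((x ∶ △ A) ∷ Γ) Ω)
  trans : ∀ {𝓡 Γ Ω x y z} (∘ • : Kind) →
         Rule (seq (rel ∘ x y ∷ rel • y z ∷ rel • x z ∷ 𝓡) Γ Ω ∷ [])
              (seq (rel ∘ x y ∷ rel • y z ∷ 𝓡) Γ Ω)

_≈S_ : Sequent → Sequent → Set
s ≈S t = (rels s ↭ rels t) × (ant s ↭ ant t) × (suc s ↭ suc t)

RuleInstance : List Sequent → Sequent → Set
RuleInstance ps c =
  Σ (List Sequent) λ ps' → Σ Sequent λ c' →
    Rule ps' c' × (c ≈S c') × Pointwise _≈S_ ps ps'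

RelHolds : (M : Carlson) → (Label → W M) → RelAtom → Set
RelHolds M I (rel R x y) = _≺_ M (I x) (I y) × M₀ M (I y)
RelHolds M I (rel S x y) = _≺_ M (I x) (I y) × M₁ M (I y)

-- I is a sequent interpretation of 𝔖 on M.  An interpretation is represented
-- by a total map Label → W; only its values on Lab(𝔖) matter.
IsInterp : (M : Carlson) → Sequent → (Label → W M) → Set
IsInterp M s I = All (RelHolds M I) (rels s)

Witnesses : (M : Carlson) → Sequent → (Label → W M) → Set
Witnesses M s I =
  IsInterp M s I
  × All (λ { (x ∶ A) → Forces M (I x) A }) (ant s)
  × All (λ { (x ∶ A) → ¬ Forces M (I x) A }) (suc s)

{-# OPTIONS --safe #-}
-- For all rules except □R and △R the
-- interpretation I itself refutes a premiss: for ⇒L the premiss is chosen by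
-- which disjunct makes A → B true, for ⇒R excluded middle yields I(x) ⊩ A, and
-- for □L, △L and trans the new items hold by the truth clauses and by
-- transitivity of ≺.  For □R/△R, excluded middle turns I(x) ⊮ □A into an
-- M₀-successor v (M₁ for △) refuting A; as the eigenlabel y is fresh, I updated
-- at y to v still agrees with I on Lab(𝔖).  Independently, every premiss
-- contains all labels of its conclusion, and permuting the multisets of a rule
-- instance preserves both refutation and label sets.
module Submission where

open import Defs
open import Level using (0ℓ)
open import Data.Nat using (_≟_)
open import Data.Product using (_×_; Σ; Σ-syntax; _,_; proj₁; proj₂; curry)
open import Data.Sum using (inj₁; inj₂; [_,_]′)
open import Data.List using (List; []; _∷_; map; concatMap)
open import Data.List.Relation.Unary.Any as Any using (Any; here; there)
open import Data.List.Relation.Unary.All as All using (All; []; _∷_)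
open import Data.List.Relation.Binary.Pointwise using (Any-resp-Pointwise; symmetric)
open import Data.List.Relation.Binary.Permutation.Propositional using (↭-sym)
open import Data.List.Relation.Binary.Permutation.Propositional.Properties using (All-resp-↭)
open import Data.List.Relation.Binary.Subset.Propositional using (_⊆_)
open import Data.List.Relation.Binary.Subset.Propositional.Properties
  using (⊆-refl; ⊆-reflexive-↭; map⁺; concatMap⁺; xs⊆x∷xs; ∷⁺ʳ; ∈-∷⁺ʳ)
open import Data.List.Membership.Propositional using (_∈_; _∉_)
open import Data.List.Membership.Propositional.Properties using (∈-++⁺ˡ; ∈-++⁺ʳ; ∈-++⁻)
open import Relation.Binary.PropositionalEquality using (_≡_; _≢_; refl; sym; cong; subst; subst₂)
open import Relation.Nullary using (¬_; yes; no)
open import Data.Empty using (⊥-elim)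
open import Axiom.ExcludedMiddle using (ExcludedMiddle)
open import Axiom.DoubleNegationElimination using (DoubleNegationElimination; em⇒dne)

Any-×-All : ∀ {A : Set} {P Q : A → Set} {xs} → Any P xs → All Q xs → Any (λ x → P x × Q x) xs
Any-×-All (here p) (q ∷ _) = here (p , q)
Any-×-All (there ps) (_ ∷ qs) = there (Any-×-All ps qs)

¬∀⇒∃¬ : DoubleNegationElimination 0ℓ → {X : Set} {P Q : X → Set} →
  ¬ (∀ x → P x → Q x) → Σ[ x ∈ X ] P x × ¬ Q x
¬∀⇒∃¬ dne ¬∀ = dne (λ ¬∃ → ¬∀ (λ x Px → dne (λ ¬Qx → ¬∃ (x , Px , ¬Qx))))

∈∧∉⇒≢ : ∀ {A : Set} {xs : List A} {z y} → z ∈ xs → y ∉ xs → z ≢ y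
∈∧∉⇒≢ z∈xs y∉xs refl = y∉xs z∈xs

endpoints : RelAtom → List Label
endpoints (rel _ x y) = x ∷ y ∷ []

labelsR≡concatMap : ∀ 𝓡 → labelsR 𝓡 ≡ concatMap endpoints 𝓡
labelsR≡concatMap [] = refl
labelsR≡concatMap (rel _ x y ∷ 𝓡) = cong (λ xs → x ∷ y ∷ xs) (labelsR≡concatMap 𝓡)

labelsF≡map : ∀ Γ → labelsF Γ ≡ map LFm.lab Γ
labelsF≡map [] = refl
labelsF≡map ((x ∶ _) ∷ Γ) = cong (x ∷_) (labelsF≡map Γ)

labelsR-mono : ∀ {𝓡 𝓡′} → 𝓡 ⊆ 𝓡′ → labelsR 𝓡 ⊆ labelsR 𝓡′
labelsR-mono {𝓡} {𝓡′} 𝓡⊆𝓡′ =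
  subst₂ _⊆_ (sym (labelsR≡concatMap 𝓡)) (sym (labelsR≡concatMap 𝓡′)) (concatMap⁺ endpoints 𝓡⊆𝓡′)

labelsF-mono : ∀ {Γ Γ′} → Γ ⊆ Γ′ → labelsF Γ ⊆ labelsF Γ′
labelsF-mono {Γ} {Γ′} Γ⊆Γ′ =
  subst₂ _⊆_ (sym (labelsF≡map Γ)) (sym (labelsF≡map Γ′)) (map⁺ LFm.lab Γ⊆Γ′)

endpoints⊆labelsR : ∀ {r 𝓡} → r ∈ 𝓡 → endpoints r ⊆ labelsR 𝓡
endpoints⊆labelsR r∈𝓡 = labelsR-mono {_ ∷ []} (∈-∷⁺ʳ r∈𝓡 (λ ()))

lab∈labelsF : ∀ {f Γ} → f ∈ Γ → LFm.lab f ∈ labelsF Γ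
lab∈labelsF f∈Γ = labelsF-mono {_ ∷ []} (∈-∷⁺ʳ f∈Γ (λ ())) (here refl)

rels⊆labels : ∀ 𝔖 → labelsR (rels 𝔖) ⊆ labels 𝔖
rels⊆labels _ = ∈-++⁺ˡ

ant⊆labels : ∀ 𝔖 → labelsF (ant 𝔖) ⊆ labels 𝔖
ant⊆labels (seq 𝓡 _ _) z∈ = ∈-++⁺ʳ (labelsR 𝓡) (∈-++⁺ˡ z∈)

suc⊆labels : ∀ 𝔖 → labelsF (suc 𝔖) ⊆ labels 𝔖
suc⊆labels (seq 𝓡 Γ _) z∈ = ∈-++⁺ʳ (labelsR 𝓡) (∈-++⁺ʳ (labelsF Γ) z∈)

labels-⊆ : ∀ 𝔖 {xs} →
  labelsR (rels 𝔖) ⊆ xs → labelsF (ant 𝔖) ⊆ xs → labelsF (suc 𝔖) ⊆ xs → labels 𝔖 ⊆ xs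
labels-⊆ (seq 𝓡 Γ _) 𝓡⊆ Γ⊆ Ω⊆ z∈ =
  [ 𝓡⊆ , (λ z∈ΓΩ → [ Γ⊆ , Ω⊆ ]′ (∈-++⁻ (labelsF Γ) z∈ΓΩ)) ]′ (∈-++⁻ (labelsR 𝓡) z∈)

≈S-sym : ∀ {𝔖 𝔗} → 𝔖 ≈S 𝔗 → 𝔗 ≈S 𝔖
≈S-sym (𝓡↭ , Γ↭ , Ω↭) = ↭-sym 𝓡↭ , ↭-sym Γ↭ , ↭-sym Ω↭

≈S⇒labels-⊆ : ∀ {𝔖 𝔗} → 𝔖 ≈S 𝔗 → labels 𝔖 ⊆ labels 𝔗
≈S⇒labels-⊆ {𝔖} {𝔗} (𝓡↭ , Γ↭ , Ω↭) =
  labels-⊆ 𝔖 (λ z∈ → rels⊆labels 𝔗 (labelsR-mono (⊆-reflexive-↭ 𝓡↭) z∈))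
           (λ z∈ → ant⊆labels 𝔗 (labelsF-mono (⊆-reflexive-↭ Γ↭) z∈))
           (λ z∈ → suc⊆labels 𝔗 (labelsF-mono (⊆-reflexive-↭ Ω↭) z∈))

modalR⇒labels-⊆ : ∀ k 𝓡 Γ Ω x y F A →
  labels (seq 𝓡 Γ ((x ∶ F) ∷ Ω)) ⊆ labels (seq (rel k x y ∷ 𝓡) Γ ((y ∶ A) ∷ Ω))
modalR⇒labels-⊆ k 𝓡 Γ Ω x y F A =
  labels-⊆ (seq 𝓡 Γ ((x ∶ F) ∷ Ω)) (λ z∈ → rels⊆labels 𝔖₁ (there (there z∈))) (ant⊆labels 𝔖₁)
           (∈-∷⁺ʳ (rels⊆labels 𝔖₁ (here refl)) (λ z∈ → suc⊆labels 𝔖₁ (there z∈)))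
  where 𝔖₁ = seq (rel k x y ∷ 𝓡) Γ ((y ∶ A) ∷ Ω)

modalL⇒labels-⊆ : ∀ k 𝓡 Γ Ω x y F A →
  labels (seq (rel k x y ∷ 𝓡) ((x ∶ F) ∷ Γ) Ω)
    ⊆ labels (seq (rel k x y ∷ 𝓡) ((x ∶ F) ∷ (y ∶ A) ∷ Γ) Ω)
modalL⇒labels-⊆ k 𝓡 Γ Ω x y F A =
  labels-⊆ (seq (rel k x y ∷ 𝓡) ((x ∶ F) ∷ Γ) Ω) (rels⊆labels 𝔖₁)
           (λ z∈ → ant⊆labels 𝔖₁ (labelsF-mono (∷⁺ʳ (x ∶ F) (xs⊆x∷xs Γ (y ∶ A))) z∈))
           (suc⊆labels 𝔖₁)
  where 𝔖₁ = seq (rel k x y ∷ 𝓡) ((x ∶ F) ∷ (y ∶ A) ∷ Γ) Ω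

Rule⇒labels-⊆ : ∀ {ps 𝔖} → Rule ps 𝔖 → All (λ 𝔖ᵢ → labels 𝔖 ⊆ labels 𝔖ᵢ) ps
Rule⇒labels-⊆ Id = []
Rule⇒labels-⊆ ⊥L = []
Rule⇒labels-⊆ {𝔖 = 𝔖} (⇒R {𝓡} {Γ} {Ω} {x} {A} {B}) =
  labels-⊆ 𝔖 (rels⊆labels 𝔖₁) (λ z∈ → ant⊆labels 𝔖₁ (there z∈)) (suc⊆labels 𝔖₁) ∷ []
  where 𝔖₁ = seq 𝓡 ((x ∶ A) ∷ Γ) ((x ∶ B) ∷ Ω)
Rule⇒labels-⊆ {𝔖 = 𝔖} (⇒L {𝓡} {Γ} {Ω} {x} {A} {B}) =
  labels-⊆ 𝔖 (rels⊆labels 𝔖₁) (∈-∷⁺ʳ (suc⊆labels 𝔖₁ (here refl)) (ant⊆labels 𝔖₁))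
             (λ z∈ → suc⊆labels 𝔖₁ (there z∈))
  ∷ ⊆-refl ∷ []
  where 𝔖₁ = seq 𝓡 Γ ((x ∶ A) ∷ Ω)
Rule⇒labels-⊆ (□R {𝓡} {Γ} {Ω} {x} {y} {A} _) = modalR⇒labels-⊆ R 𝓡 Γ Ω x y (□ A) A ∷ []
Rule⇒labels-⊆ (□L {𝓡} {Γ} {Ω} {x} {y} {A}) = modalL⇒labels-⊆ R 𝓡 Γ Ω x y (□ A) A ∷ []
Rule⇒labels-⊆ (△R {𝓡} {Γ} {Ω} {x} {y} {A} _) = modalR⇒labels-⊆ S 𝓡 Γ Ω x y (△ A) A ∷ []
Rule⇒labels-⊆ (△L {𝓡} {Γ} {Ω} {x} {y} {A}) = modalL⇒labels-⊆ S 𝓡 Γ Ω x y (△ A) A ∷ []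
Rule⇒labels-⊆ {𝔖 = 𝔖} (trans {𝓡} {Γ} {Ω} {x} {y} {z} ∘ •) =
  labels-⊆ 𝔖 (λ z∈ → rels⊆labels 𝔖₁ (labelsR-mono 𝓡⊆𝓡₁ z∈)) (ant⊆labels 𝔖₁) (suc⊆labels 𝔖₁) ∷ []
  where
  𝔖₁ = seq (rel ∘ x y ∷ rel • y z ∷ rel • x z ∷ 𝓡) Γ Ω
  𝓡⊆𝓡₁ = ∷⁺ʳ (rel ∘ x y) (∷⁺ʳ (rel • y z) (xs⊆x∷xs 𝓡 (rel • x z)))

AgreeOn : {X : Set} → List Label → (Label → X) → (Label → X) → Set
AgreeOn xs I J = ∀ {z} → z ∈ xs → J z ≡ I z

_[_↦_] : {X : Set} → (Label → X) → Label → X → Label → X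
(I [ y ↦ v ]) z with z ≟ y
... | yes _ = v
... | no  _ = I z

[↦]-same : ∀ {X : Set} (I : Label → X) y v → (I [ y ↦ v ]) y ≡ v
[↦]-same I y v with y ≟ y
... | yes _ = refl
... | no y≢y = ⊥-elim (y≢y refl)

[↦]-other : ∀ {X : Set} (I : Label → X) {y v z} → z ≢ y → (I [ y ↦ v ]) z ≡ I z
[↦]-other I {y} {z = z} z≢y with z ≟ y
... | yes z≡y = ⊥-elim (z≢y z≡y)
... | no  _ = refl

[↦]-agree : ∀ {X : Set} (I : Label → X) {xs y v} → y ∉ xs → AgreeOn xs I (I [ y ↦ v ])
[↦]-agree I y∉xs z∈xs = [↦]-other I (∈∧∉⇒≢ z∈xs y∉xs)

ExtendingWitness : (M : Carlson) → (Label → W M) → Sequent → Sequent → Set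
ExtendingWitness M I 𝔖 𝔖ᵢ =
  Σ (Label → W M) λ J → Witnesses M 𝔖ᵢ J × (∀ x → x ∈ labels 𝔖 → (x ∈ labels 𝔖ᵢ) × (J x ≡ I x))

AgreeingWitness : (M : Carlson) → List Label → (Label → W M) → Sequent → Set
AgreeingWitness M xs I 𝔖 = Σ[ J ∈ (Label → W M) ] Witnesses M 𝔖 J × AgreeOn xs I J

module _ {M : Carlson} where

  RelHolds-cong : ∀ {I J : Label → W M} r →
    J (RelAtom.src r) ≡ I (RelAtom.src r) → J (RelAtom.tgt r) ≡ I (RelAtom.tgt r) →
    RelHolds M I r → RelHolds M J r
  RelHolds-cong (rel R _ _) x≡ y≡ = subst₂ (λ v w → _≺_ M v w × M₀ M w) (sym x≡) (sym y≡)
  RelHolds-cong (rel S _ _) x≡ y≡ = subst₂ (λ v w → _≺_ M v w × M₁ M w) (sym x≡) (sym y≡)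

  Witnesses-cong : ∀ 𝔖 {I J : Label → W M} → AgreeOn (labels 𝔖) I J → Witnesses M 𝔖 I → Witnesses M 𝔖 J
  Witnesses-cong 𝔖 {I} {J} I≗J (𝓡✓ , Γ✓ , Ω✓) =
      All.tabulate (λ {r} r∈ →
        RelHolds-cong r (onR r∈ (here refl)) (onR r∈ (there (here refl))) (All.lookup 𝓡✓ r∈))
    , All.tabulate (λ {f} f∈ → subst (λ v → Forces M v (LFm.fm f)) (sym (onΓ f∈)) (All.lookup Γ✓ f∈))
    , All.tabulate (λ {f} f∈ → subst (λ v → ¬ Forces M v (LFm.fm f)) (sym (onΩ f∈)) (All.lookup Ω✓ f∈))
    where
    onR : ∀ {r} → r ∈ rels 𝔖 → AgreeOn (endpoints r) I J
    onR r∈ z∈ = I≗J (rels⊆labels 𝔖 (endpoints⊆labelsR r∈ z∈))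
    onΓ : ∀ {f} → f ∈ ant 𝔖 → J (LFm.lab f) ≡ I (LFm.lab f)
    onΓ f∈ = I≗J (ant⊆labels 𝔖 (lab∈labelsF f∈))
    onΩ : ∀ {f} → f ∈ suc 𝔖 → J (LFm.lab f) ≡ I (LFm.lab f)
    onΩ f∈ = I≗J (suc⊆labels 𝔖 (lab∈labelsF f∈))

  Witnesses-resp-≈S : ∀ {𝔖 𝔗} {I : Label → W M} → 𝔖 ≈S 𝔗 → Witnesses M 𝔖 I → Witnesses M 𝔗 I
  Witnesses-resp-≈S (𝓡↭ , Γ↭ , Ω↭) (𝓡✓ , Γ✓ , Ω✓) =
    All-resp-↭ 𝓡↭ 𝓡✓ , All-resp-↭ Γ↭ Γ✓ , All-resp-↭ Ω↭ Ω✓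

  RelHolds⇒≺ : ∀ {I : Label → W M} k {x y} → RelHolds M I (rel k x y) → _≺_ M (I x) (I y)
  RelHolds⇒≺ R (x≺y , _) = x≺y
  RelHolds⇒≺ S (x≺y , _) = x≺y

  RelHolds-trans : ∀ {I : Label → W M} k l {x y z} →
    RelHolds M I (rel k x y) → RelHolds M I (rel l y z) → RelHolds M I (rel l x z)
  RelHolds-trans k R xy (y≺z , z∈M₀) = ≺-trans M (RelHolds⇒≺ k xy) y≺z , z∈M₀
  RelHolds-trans k S xy (y≺z , z∈M₁) = ≺-trans M (RelHolds⇒≺ k xy) y≺z , z∈M₁

modal : Kind → Fm → Fm
modal R = □
modal S = △

module _ {M : Carlson} (dne : DoubleNegationElimination 0ℓ) where

  modal-counterexample : ∀ k {A} (I : Label → W M) {x y} → x ≢ y → ¬ Forces M (I x) (modal k A) →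
    Σ[ v ∈ W M ] RelHolds M (I [ y ↦ v ]) (rel k x y) × ¬ Forces M v A
  modal-counterexample R I {y = y} x≢y ¬□A with ¬∀⇒∃¬ dne (λ ∀A → ¬□A (λ v → curry (∀A v)))
  ... | v , (x≺v , v∈M₀) , ¬A =
    v , subst₂ (λ a b → _≺_ M a b × M₀ M b) (sym ([↦]-other I x≢y)) (sym ([↦]-same I y v)) (x≺v , v∈M₀)
      , ¬A
  modal-counterexample S I {y = y} x≢y ¬△A with ¬∀⇒∃¬ dne (λ ∀A → ¬△A (λ v → curry (∀A v)))
  ... | v , (x≺v , v∈M₁) , ¬A =
    v , subst₂ (λ a b → _≺_ M a b × M₁ M b) (sym ([↦]-other I x≢y)) (sym ([↦]-same I y v)) (x≺v , v∈M₁)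
      , ¬A

  fresh-witness : ∀ k {𝓡 Γ Ω x y A} {I : Label → W M} →
    y ∉ labels (seq 𝓡 Γ ((x ∶ modal k A) ∷ Ω)) →
    Witnesses M (seq 𝓡 Γ ((x ∶ modal k A) ∷ Ω)) I →
    AgreeingWitness M (labels (seq 𝓡 Γ ((x ∶ modal k A) ∷ Ω))) I (seq (rel k x y ∷ 𝓡) Γ ((y ∶ A) ∷ Ω))
  fresh-witness k {𝓡} {Γ} {Ω} {x} {y} {A} {I} y∉𝔖 w@(_ , _ , ¬modalA ∷ _)
    with modal-counterexample k I
           (∈∧∉⇒≢ (suc⊆labels (seq 𝓡 Γ ((x ∶ modal k A) ∷ Ω)) (here refl)) y∉𝔖) ¬modalA
  ... | v , xRy , ¬A with Witnesses-cong _ ([↦]-agree I y∉𝔖) w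
  ... | 𝓡✓ , Γ✓ , _ ∷ Ω✓ =
    I [ y ↦ v ]
    , (xRy ∷ 𝓡✓ , Γ✓ , subst (λ u → ¬ Forces M u A) (sym ([↦]-same I y v)) ¬A ∷ Ω✓)
    , [↦]-agree I y∉𝔖

  unchanged : ∀ {xs 𝔖} {I : Label → W M} → Witnesses M 𝔖 I → AgreeingWitness M xs I 𝔖
  unchanged {I = I} w = I , w , λ _ → refl

  Rule⇒premiss-witness : ∀ {ps 𝔖} {I : Label → W M} →
    Rule ps 𝔖 → Witnesses M 𝔖 I → Any (AgreeingWitness M (labels 𝔖) I) ps
  Rule⇒premiss-witness Id (_ , p ∷ _ , ¬p ∷ _) = ⊥-elim (¬p p)
  Rule⇒premiss-witness ⊥L (_ , () ∷ _ , _)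
  Rule⇒premiss-witness ⇒R (𝓡✓ , Γ✓ , ¬A⇒B ∷ Ω✓) =
    here (unchanged (𝓡✓ , dne (λ ¬A → ¬A⇒B (inj₁ ¬A)) ∷ Γ✓ , (λ B → ¬A⇒B (inj₂ B)) ∷ Ω✓))
  Rule⇒premiss-witness ⇒L (𝓡✓ , inj₁ ¬A ∷ Γ✓ , Ω✓) = here (unchanged (𝓡✓ , Γ✓ , ¬A ∷ Ω✓))
  Rule⇒premiss-witness ⇒L (𝓡✓ , inj₂ B ∷ Γ✓ , Ω✓) = there (here (unchanged (𝓡✓ , B ∷ Γ✓ , Ω✓)))
  Rule⇒premiss-witness (□R y∉𝔖) w = here (fresh-witness R y∉𝔖 w)
  Rule⇒premiss-witness (△R y∉𝔖) w = here (fresh-witness S y∉𝔖 w)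
  Rule⇒premiss-witness □L ((x≺y , y∈M₀) ∷ 𝓡✓ , □A ∷ Γ✓ , Ω✓) =
    here (unchanged ((x≺y , y∈M₀) ∷ 𝓡✓ , □A ∷ □A _ x≺y y∈M₀ ∷ Γ✓ , Ω✓))
  Rule⇒premiss-witness △L ((x≺y , y∈M₁) ∷ 𝓡✓ , △A ∷ Γ✓ , Ω✓) =
    here (unchanged ((x≺y , y∈M₁) ∷ 𝓡✓ , △A ∷ △A _ x≺y y∈M₁ ∷ Γ✓ , Ω✓))
  Rule⇒premiss-witness (trans k l) (xy ∷ yz ∷ 𝓡✓ , Γ✓ , Ω✓) =
    here (unchanged (xy ∷ yz ∷ RelHolds-trans k l xy yz ∷ 𝓡✓ , Γ✓ , Ω✓))

module _ {M : Carlson} {I : Label → W M} (𝔖 : Sequent) where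

  AgreeingWitness⇒ExtendingWitness : ∀ {xs 𝔖ᵢ} → labels 𝔖 ⊆ xs →
    AgreeingWitness M xs I 𝔖ᵢ × xs ⊆ labels 𝔖ᵢ → ExtendingWitness M I 𝔖 𝔖ᵢ
  AgreeingWitness⇒ExtendingWitness 𝔖⊆xs ((J , wᵢ , I≗J) , xs⊆𝔖ᵢ) =
    J , wᵢ , λ x x∈𝔖 → xs⊆𝔖ᵢ (𝔖⊆xs x∈𝔖) , I≗J (𝔖⊆xs x∈𝔖)

  ExtendingWitness-resp-≈S : ∀ {𝔖ᵢ 𝔗} →
    𝔖ᵢ ≈S 𝔗 → ExtendingWitness M I 𝔖 𝔖ᵢ → ExtendingWitness M I 𝔖 𝔗
  ExtendingWitness-resp-≈S 𝔖ᵢ≈𝔗 (J , wᵢ , extends) =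
    J , Witnesses-resp-≈S 𝔖ᵢ≈𝔗 wᵢ
      , λ x x∈𝔖 → ≈S⇒labels-⊆ 𝔖ᵢ≈𝔗 (proj₁ (extends x x∈𝔖)) , proj₂ (extends x x∈𝔖)

corollary1 : ExcludedMiddle 0ℓ →
    (M : Carlson) (ps : List Sequent) (𝔖 : Sequent) →
    RuleInstance ps 𝔖 →
    (I : Label → W M) → Witnesses M 𝔖 I →
    Any (λ 𝔖ᵢ → Σ (Label → W M) λ I' →
           Witnesses M 𝔖ᵢ I'
           × (∀ x → x ∈ labels 𝔖 → (x ∈ labels 𝔖ᵢ) × (I' x ≡ I x)))
        ps
corollary1 em M ps 𝔖 (ps′ , 𝔖′ , rule , 𝔖≈𝔖′ , ps≈ps′) I w =
  Any-resp-Pointwise (ExtendingWitness-resp-≈S 𝔖) (symmetric ≈S-sym ps≈ps′) (Any.map extending premiss)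
  where
  premiss : Any (λ 𝔖ᵢ → AgreeingWitness M (labels 𝔖′) I 𝔖ᵢ × labels 𝔖′ ⊆ labels 𝔖ᵢ) ps′
  premiss = Any-×-All (Rule⇒premiss-witness (em⇒dne em) rule (Witnesses-resp-≈S 𝔖≈𝔖′ w))
                      (Rule⇒labels-⊆ rule)
  extending : ∀ {𝔖ᵢ} →
    AgreeingWitness M (labels 𝔖′) I 𝔖ᵢ × labels 𝔖′ ⊆ labels 𝔖ᵢ → ExtendingWitness M I 𝔖 𝔖ᵢ
  extending = AgreeingWitness⇒ExtendingWitness 𝔖 (≈S⇒labels-⊆ 𝔖≈𝔖′)
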